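{- Let $a,b\in\mathbb{Z}$, $q\in\mathbb{Z}\setminus\{0\}$, and $w_r=w_r(a,b,q)$ given by $w_0=a$, $w_1=b$, $w_r=qw_{r-1}+w_{r-2}$. Suppose that $5\nmid q(q^2+4)$, that $m$ is a positive integer with $5\mid m$, and that $a^2+qab-b^2\equiv\pm1\pmod 5$. Suppose further that $k(5m)=5k(m)$ and that $(w_r)$ modulo $m$ is residue complete. Then $(w_r)$ modulo $5m$ is residue complete.
   Context: For a positive integer $n$, $k(n)$ denotes the order of $\sigma=\begin{pmatrix} q&1\\ 1&0\end{pmatrix}$ modulo $n$, i.e. the smallest positive integer $k$ with $\sigma^k\equiv I\pmod n$. A sequence is residue complete modulo $n$ if every residue class of $\mathbb{Z}_n$ occurs among its terms modulo $n$. -}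

module Defs where

open import Data.Nat using (ℕ; zero; suc) renaming (_<_ to _<ℕ_; _*_ to _*ℕ_)
open import Data.Integer using (ℤ; +_; _+_; _-_; _*_; -_)
open import Data.Integer.Divisibility using (_∣_)
open import Data.Product using (_×_; ∃)
open import Relation.Nullary using (¬_)

_≡_[mod_] : ℤ → ℤ → ℤ → Set
x ≡ y [mod n ] = n ∣ (x - y)

w : ℤ → ℤ → ℤ → ℕ → ℤ
w a b q zero = a
w a b q (suc zero) = b
w a b q (suc (suc r)) = q * w a b q (suc r) + w a b q r

record Mat2 : Set where
  constructor mat
  field
    m11 m12 m21 m22 : ℤ
open Mat2 public

_⊗_ : Mat2 → Mat2 → Mat2
mat a b c d ⊗ mat e f g h = mat (a * e + b * g) (a * f + b * h) (c * e + d * g) (c * f + d * h)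

I₂ : Mat2
I₂ = mat (+ 1) (+ 0) (+ 0) (+ 1)

σ : ℤ → Mat2
σ q = mat q (+ 1) (+ 1) (+ 0)

_^M_ : Mat2 → ℕ → Mat2
A ^M zero = I₂
A ^M suc k = A ⊗ (A ^M k)

_≡M_[mod_] : Mat2 → Mat2 → ℤ → Set
A ≡M B [mod n ] = (m11 A ≡ m11 B [mod n ]) × (m12 A ≡ m12 B [mod n ])
                × (m21 A ≡ m21 B [mod n ]) × (m22 A ≡ m22 B [mod n ])

IsOrder : ℤ → ℕ → ℕ → Set
IsOrder q n k = (0 <ℕ k) × ((σ q ^M k) ≡M I₂ [mod + n ])
              × (∀ j → 0 <ℕ j → j <ℕ k → ¬ ((σ q ^M j) ≡M I₂ [mod + n ]))

ResidueComplete : (ℕ → ℤ) → ℕ → Set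
ResidueComplete s n = ∀ (c : ℤ) → ∃ λ r → s r ≡ c [mod + n ]

-- Since σ^k ≡ I (mod m) and σ^k has the shape (q x + y, x; x, y), we can write
-- σ^k = I + m (q s + u, s; s, u); hence w (k + n) = w n + m d n with d n = s w (n+1) + u w n, and
-- because 5 ∣ m, iterating gives w (j k + n) ≡ w n + j m d n (mod 5 m). So every residue mod 5 m
-- lying over w r mod m is reached as soon as 5 ∤ d r. Taking determinants (det σ^k = ±1) shows
-- 5 ∣ q s + 2 u, and k(5 m) ≠ k(m) shows that 5 does not divide both s and u. If 5 ∣ d r,
-- these force 2 w (r+1) ≡ q w r (mod 5); completing the square,
-- 4 (A² + q A B − B²) = (q² + 4) A² − (2 B − q A)², then turns the invariant
-- w r² + q w r w (r+1) − w (r+1)² ≡ ±1 into (q² + 4) w r² ≡ ±4 (mod 5). This is impossible,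
-- as 5 ∤ q (q² + 4) forces q² + 4 ≡ 3, which is not ± a square mod 5.
module Submission where

open import Defs
open import Data.Nat using (ℕ; NonZero) renaming (_*_ to _*ℕ_; _<_ to _<ℕ_)
open import Data.Integer using (ℤ; +_; _+_; _-_; _*_; -_)
open import Data.Integer.Divisibility using (_∣_)
open import Data.Product using (_×_; ∃)
open import Data.Sum using (_⊎_)
open import Relation.Nullary using (¬_)
open import Relation.Binary.PropositionalEquality using (_≢_)

open import Data.Nat using (zero; suc) renaming (_+_ to _+ℕ_)
import Data.Nat.Properties as ℕ
import Data.Nat.Divisibility as ℕ
open import Data.Nat.Primality using (Prime; prime?; euclidsLemma)
open import Data.Integer using (∣_∣; _/ℕ_)
open import Data.Integer.Properties
  using (abs-*; pos-+; pos-*; neg-involutive; -1*i≡-i; *-zeroʳ; +-identityˡ; +-identityʳ; +-inverseʳ; *-comm;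
         i*j≡0⇒i≡0∨j≡0)
import Data.Integer.Divisibility.Signed as Signed
open Signed using (divides) renaming (_∣_ to _∣ₛ_; _∣?_ to _∣ₛ?_)
open import Data.Integer.DivMod using (a≡a%ℕn+[a/ℕn]*n; n%ℕd<d)
open import Data.Integer.Tactic.RingSolver using (solve-∀)
open import Data.Fin using (Fin; toℕ; fromℕ<)
open import Data.Fin.Properties using (all?; any?; toℕ-fromℕ<)
open import Data.Product using (_,_; proj₂; ∃₂)
open import Data.Sum using (inj₁; inj₂)
import Data.Sum as Sum
open import Data.Empty using (⊥-elim)
open import Function using (_∘_; id)
open import Level using (0ℓ)
open import Relation.Nullary using (Dec)
import Relation.Nullary.Decidable as Dec
open import Relation.Nullary.Decidable using (from-yes; from-no; ¬?; _⊎-dec_; _→-dec_)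
open import Relation.Binary.Bundles using (Setoid)
open import Relation.Binary.PropositionalEquality
  using (_≡_; refl; sym; trans; cong; cong₂; subst; module ≡-Reasoning)
import Relation.Binary.Reasoning.Setoid as SetoidReasoning

infix 4 _≡_⟨mod_⟩ _≡?_⟨mod_⟩ _≡±_⟨mod_⟩

-- _≡_[mod_] wrapped in a record, so that x, y and n can be inferred from a proof.
record _≡_⟨mod_⟩ (x y n : ℤ) : Set where
  constructor mod
  field unmod : x ≡ y [mod n ]
open _≡_⟨mod_⟩

module _ {n : ℤ} where

  mod⇒∣ : ∀ {x y} → x ≡ y ⟨mod n ⟩ → n ∣ₛ x - y
  mod⇒∣ {x} {y} (mod p) = Signed.∣ᵤ⇒∣ {n} {x - y} p

  ∣⇒mod : ∀ {x y} → n ∣ₛ x - y → x ≡ y ⟨mod n ⟩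
  ∣⇒mod = mod ∘ Signed.∣⇒∣ᵤ

  private
    via : ∀ {x y z} → z ≡ x - y → n ∣ₛ z → x ≡ y ⟨mod n ⟩
    via refl = ∣⇒mod

  mod-reflexive : ∀ {x y} → x ≡ y → x ≡ y ⟨mod n ⟩
  mod-reflexive {x} refl = via (sym (+-inverseʳ x)) (divides (+ 0) refl)

  mod-refl : ∀ {x} → x ≡ x ⟨mod n ⟩
  mod-refl = mod-reflexive refl

  mod-sym : ∀ {x y} → x ≡ y ⟨mod n ⟩ → y ≡ x ⟨mod n ⟩
  mod-sym {x} {y} p = via (identity x y) (Signed.∣m⇒∣-m (mod⇒∣ p))
    where
    identity : ∀ x y → - (x - y) ≡ y - x
    identity = solve-∀

  mod-trans : ∀ {x y z} → x ≡ y ⟨mod n ⟩ → y ≡ z ⟨mod n ⟩ → x ≡ z ⟨mod n ⟩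
  mod-trans {x} {y} {z} p q = via (identity x y z) (Signed.∣m∣n⇒∣m+n (mod⇒∣ p) (mod⇒∣ q))
    where
    identity : ∀ x y z → (x - y) + (y - z) ≡ x - z
    identity = solve-∀

  mod-+-cong : ∀ {x x′ y y′} → x ≡ x′ ⟨mod n ⟩ → y ≡ y′ ⟨mod n ⟩ → x + y ≡ x′ + y′ ⟨mod n ⟩
  mod-+-cong {x} {x′} {y} {y′} p q = via (identity x x′ y y′) (Signed.∣m∣n⇒∣m+n (mod⇒∣ p) (mod⇒∣ q))
    where
    identity : ∀ x x′ y y′ → (x - x′) + (y - y′) ≡ (x + y) - (x′ + y′)
    identity = solve-∀

  mod-*-cong : ∀ {x x′ y y′} → x ≡ x′ ⟨mod n ⟩ → y ≡ y′ ⟨mod n ⟩ → x * y ≡ x′ * y′ ⟨mod n ⟩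
  mod-*-cong {x} {x′} {y} {y′} p q = via (identity x x′ y y′)
    (Signed.∣m∣n⇒∣m+n (Signed.∣m⇒∣m*n y (mod⇒∣ p)) (Signed.∣n⇒∣m*n x′ (mod⇒∣ q)))
    where
    identity : ∀ x x′ y y′ → (x - x′) * y + x′ * (y - y′) ≡ x * y - x′ * y′
    identity = solve-∀

  mod-neg-cong : ∀ {x y} → x ≡ y ⟨mod n ⟩ → - x ≡ - y ⟨mod n ⟩
  mod-neg-cong {x} {y} p = via (identity x y) (Signed.∣m⇒∣-m (mod⇒∣ p))
    where
    identity : ∀ x y → - (x - y) ≡ - x - - y
    identity = solve-∀

  ∣⇒+-mod : ∀ {x y} → n ∣ₛ y → x + y ≡ x ⟨mod n ⟩
  ∣⇒+-mod {x} {y} = via (identity x y)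
    where
    identity : ∀ x y → y ≡ (x + y) - x
    identity = solve-∀

  ∣⇒≡0-mod : ∀ {x} → n ∣ₛ x → x ≡ + 0 ⟨mod n ⟩
  ∣⇒≡0-mod {x} = via (sym (+-identityʳ x))

  ∣-resp-mod : ∀ {x y} → x ≡ y ⟨mod n ⟩ → n ∣ₛ y → n ∣ₛ x
  ∣-resp-mod {x} {y} p q = subst (n ∣ₛ_) (identity x y) (Signed.∣m∣n⇒∣m+n (mod⇒∣ p) q)
    where
    identity : ∀ x y → (x - y) + y ≡ x
    identity = solve-∀

  mod-witness : ∀ {x y} → x ≡ y ⟨mod n ⟩ → ∃ λ t → x ≡ y + n * t
  mod-witness {x} {y} p with mod⇒∣ p
  ... | divides t x-y≡t*n = t , (begin
    x             ≡⟨ identity x y ⟩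
    y + (x - y)   ≡⟨ cong (λ z → y + z) x-y≡t*n ⟩
    y + t * n     ≡⟨ cong (λ z → y + z) (*-comm t n) ⟩
    y + n * t     ∎)
    where
    open ≡-Reasoning
    identity : ∀ x y → x ≡ y + (x - y)
    identity = solve-∀

mod-setoid : ℤ → Setoid 0ℓ 0ℓ
mod-setoid n = record
  { Carrier = ℤ
  ; _≈_ = _≡_⟨mod n ⟩
  ; isEquivalence = record { refl = mod-refl ; sym = mod-sym ; trans = mod-trans }
  }

_≡?_⟨mod_⟩ : ∀ x y n → Dec (x ≡ y ⟨mod n ⟩)
x ≡? y ⟨mod n ⟩ = Dec.map′ mod unmod (∣ n ∣ ℕ.∣? ∣ x - y ∣)

_≡±_⟨mod_⟩ : ℤ → ℤ → ℤ → Set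
x ≡± y ⟨mod n ⟩ = x ≡ y ⟨mod n ⟩ ⊎ x ≡ - y ⟨mod n ⟩

≡±-neg : ∀ {n x y} → x ≡± y ⟨mod n ⟩ → - x ≡± y ⟨mod n ⟩
≡±-neg {y = y} = Sum.[ inj₂ ∘ mod-neg-cong , inj₁ ∘ neg-neg ]′
  where
  neg-neg : ∀ {n x} → x ≡ - y ⟨mod n ⟩ → - x ≡ y ⟨mod n ⟩
  neg-neg p = mod-trans (mod-neg-cong p) (mod-reflexive (neg-involutive y))

residue : ∀ n .{{_ : NonZero n}} x → ∃ λ (r : Fin n) → x ≡ + toℕ r ⟨mod + n ⟩
residue n x = r , mod-trans (mod-reflexive x≡r+qn) (∣⇒+-mod (Signed.∣n⇒∣m*n (x /ℕ n) Signed.∣-refl))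
  where
  r : Fin n
  r = fromℕ< (n%ℕd<d x n)
  x≡r+qn : x ≡ + toℕ r + (x /ℕ n) * + n
  x≡r+qn = trans (a≡a%ℕn+[a/ℕn]*n x n) (cong (λ i → + i + (x /ℕ n) * + n) (sym (toℕ-fromℕ< _)))

p∣x⇒pM∣Mx : ∀ {p M x} → + p ∣ₛ x → + (p *ℕ M) ∣ₛ + M * x
p∣x⇒pM∣Mx {p} {M} {x} (divides t x≡tp) = divides t (begin
  + M * x            ≡⟨ cong (+ M *_) x≡tp ⟩
  + M * (t * + p)    ≡⟨ identity (+ M) t (+ p) ⟩
  t * (+ p * + M)    ≡⟨ cong (t *_) (sym (pos-* p M)) ⟩
  t * + (p *ℕ M)     ∎)
  where
  open ≡-Reasoning
  identity : ∀ m t p → m * (t * p) ≡ t * (p * m)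
  identity = solve-∀

*-lift-mod : ∀ {p M x y} → + p ∣ₛ + M → x ≡ y ⟨mod + M ⟩ → + M * x ≡ + M * y ⟨mod + (p *ℕ M) ⟩
*-lift-mod {p} {M} {x} {y} p∣M x≡y =
  ∣⇒mod (subst (+ (p *ℕ M) ∣ₛ_) (identity (+ M) x y) (p∣x⇒pM∣Mx (Signed.∣-trans p∣M (mod⇒∣ x≡y))))
  where
  identity : ∀ m x y → m * (x - y) ≡ m * x - m * y
  identity = solve-∀

euclidsLemmaℤ : ∀ {p} x y → Prime p → + p ∣ₛ x * y → + p ∣ₛ x ⊎ + p ∣ₛ y
euclidsLemmaℤ {p} x y p-prime p∣xy =
  Sum.map (Signed.∣ᵤ⇒∣ {+ p} {x}) (Signed.∣ᵤ⇒∣ {+ p} {y})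
    (euclidsLemma ∣ x ∣ ∣ y ∣ p-prime (subst (p ℕ.∣_) (abs-* x y) (Signed.∣⇒∣ᵤ p∣xy)))

5-prime : Prime 5
5-prime = from-yes (prime? 5)

private
  ≢±4-on-residues : ∀ (i j : Fin 5) → let q = + toℕ i ; A = + toℕ j in
    ¬ (+ 5 ∣ₛ q * (q * q + + 4)) → ¬ (A * A * (q * q + + 4) ≡± + 4 ⟨mod + 5 ⟩)
  ≢±4-on-residues = from-yes (all? λ (i : Fin 5) → all? λ (j : Fin 5) → let q = + toℕ i ; A = + toℕ j in
    ¬? (+ 5 ∣ₛ? q * (q * q + + 4)) →-dec
    ¬? (A * A * (q * q + + 4) ≡? + 4 ⟨mod + 5 ⟩ ⊎-dec A * A * (q * q + + 4) ≡? - + 4 ⟨mod + 5 ⟩))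

  solvable-on-residues : ∀ (i l : Fin 5) → ¬ (+ 5 ∣ₛ + toℕ l) → ∃ λ (j : Fin 5) → + 5 ∣ₛ + toℕ i + + toℕ j * + toℕ l
  solvable-on-residues = from-yes (all? λ (i : Fin 5) → all? λ (l : Fin 5) →
    ¬? (+ 5 ∣ₛ? + toℕ l) →-dec any? λ (j : Fin 5) → + 5 ∣ₛ? + toℕ i + + toℕ j * + toℕ l)

A²[q²+4]≢±4-mod5 : ∀ q A → ¬ (+ 5 ∣ₛ q * (q * q + + 4)) → ¬ (A * A * (q * q + + 4) ≡± + 4 ⟨mod + 5 ⟩)
A²[q²+4]≢±4-mod5 q A 5∤q[q²+4] =
  let i , q≡i = residue 5 q
      j , A≡j = residue 5 A
      A²[q²+4]≡ = mod-*-cong (mod-*-cong A≡j A≡j) (q²+4-cong q≡i)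
  in ≢±4-on-residues i j (5∤q[q²+4] ∘ ∣-resp-mod (mod-*-cong q≡i (q²+4-cong q≡i)))
     ∘ Sum.map (mod-trans (mod-sym A²[q²+4]≡)) (mod-trans (mod-sym A²[q²+4]≡))
  where
  q²+4-cong : ∀ {q q′} → q ≡ q′ ⟨mod + 5 ⟩ → q * q + + 4 ≡ q′ * q′ + + 4 ⟨mod + 5 ⟩
  q²+4-cong q≡q′ = mod-+-cong (mod-*-cong q≡q′ q≡q′) mod-refl

linear-solvable-mod5 : ∀ t d → ¬ (+ 5 ∣ₛ d) → ∃ λ (j : ℕ) → + 5 ∣ₛ t + + j * d
linear-solvable-mod5 t d 5∤d =
  let i , t≡i = residue 5 t
      l , d≡l = residue 5 d
      j , 5∣i+jl = solvable-on-residues i l (5∤d ∘ ∣-resp-mod d≡l)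
  in toℕ j , ∣-resp-mod (mod-+-cong t≡i (mod-*-cong (mod-refl {x = + toℕ j}) d≡l)) 5∣i+jl

form : ℤ → ℤ → ℤ → ℤ
form q A B = A * A + q * A * B - B * B

A²[q²+4]≡4·form : ∀ {n} q A B → n ∣ₛ + 2 * B - q * A → A * A * (q * q + + 4) ≡ + 4 * form q A B ⟨mod n ⟩
A²[q²+4]≡4·form {n} q A B n∣E = begin
  A * A * (q * q + + 4)     ≡⟨ identity q A B ⟩
  + 4 * form q A B + E * E  ≈⟨ mod-+-cong (mod-refl {x = + 4 * form q A B}) (mod-*-cong E≡0 E≡0) ⟩
  + 4 * form q A B + + 0    ≡⟨ +-identityʳ _ ⟩
  + 4 * form q A B          ∎
  where
  open SetoidReasoning (mod-setoid n)
  E : ℤ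
  E = + 2 * B - q * A
  E≡0 : E ≡ + 0 ⟨mod n ⟩
  E≡0 = ∣⇒≡0-mod n∣E
  identity : ∀ q A B → A * A * (q * q + + 4) ≡ + 4 * (A * A + q * A * B - B * B) + (+ 2 * B - q * A) * (+ 2 * B - q * A)
  identity = solve-∀

∣s[2B-qA] : ∀ {n} q s u A B → n ∣ₛ s * B + u * A → n ∣ₛ q * s + + 2 * u → n ∣ₛ s * (+ 2 * B - q * A)
∣s[2B-qA] {n} q s u A B n∣sB+uA n∣qs+2u = subst (n ∣ₛ_) (identity q s u A B)
  (Signed.∣m∣n⇒∣m-n (Signed.∣n⇒∣m*n (+ 2) n∣sB+uA) (Signed.∣n⇒∣m*n A n∣qs+2u))
  where
  identity : ∀ q s u A B → + 2 * (s * B + u * A) - A * (q * s + + 2 * u) ≡ s * (+ 2 * B - q * A)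
  identity = solve-∀

5∤sB+uA : ∀ q s u A B → ¬ (+ 5 ∣ₛ q * (q * q + + 4)) → + 5 ∣ₛ q * s + + 2 * u → ¬ (+ 5 ∣ₛ s × + 5 ∣ₛ u)
        → form q A B ≡± + 1 ⟨mod + 5 ⟩ → ¬ (+ 5 ∣ₛ s * B + u * A)
5∤sB+uA q s u A B 5∤q[q²+4] 5∣qs+2u ¬[5∣s×5∣u] N≡±1 5∣sB+uA =
  Sum.[ 5∤s , 5∤2B-qA ]′ (euclidsLemmaℤ s (+ 2 * B - q * A) 5-prime (∣s[2B-qA] q s u A B 5∣sB+uA 5∣qs+2u))
  where
  5∤s : ¬ (+ 5 ∣ₛ s)
  5∤s 5∣s = ¬[5∣s×5∣u] (5∣s , 5∣u)
    where
    identity : ∀ q s u → q * s + + 2 * u - q * s ≡ + 2 * u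
    identity = solve-∀
    5∣2u : + 5 ∣ₛ + 2 * u
    5∣2u = subst (+ 5 ∣ₛ_) (identity q s u) (Signed.∣m∣n⇒∣m-n 5∣qs+2u (Signed.∣n⇒∣m*n q 5∣s))
    5∣u : + 5 ∣ₛ u
    5∣u = Sum.[ ⊥-elim ∘ from-no (+ 5 ∣ₛ? + 2) , id ]′ (euclidsLemmaℤ (+ 2) u 5-prime 5∣2u)
  5∤2B-qA : ¬ (+ 5 ∣ₛ + 2 * B - q * A)
  5∤2B-qA 5∣E = A²[q²+4]≢±4-mod5 q A 5∤q[q²+4]
    (Sum.map (mod-trans A²[q²+4]≡) (mod-trans A²[q²+4]≡)
      (Sum.map (mod-*-cong (mod-refl {x = + 4})) (mod-*-cong (mod-refl {x = + 4})) N≡±1))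
    where
    A²[q²+4]≡ : A * A * (q * q + + 4) ≡ + 4 * form q A B ⟨mod + 5 ⟩
    A²[q²+4]≡ = A²[q²+4]≡4·form q A B 5∣E

det : Mat2 → ℤ
det A = m11 A * m22 A - m12 A * m21 A

det-⊗ : ∀ A B → det (A ⊗ B) ≡ det A * det B
det-⊗ (mat a b c d) (mat e f g h) = identity a b c d e f g h
  where
  identity : ∀ a b c d e f g h → (a * e + b * g) * (c * f + d * h) - (a * f + b * h) * (c * e + d * g)
                               ≡ (a * d - b * c) * (e * h - f * g)
  identity = solve-∀

det-σ^ : ∀ q k → det (σ q ^M k) ≡ + 1 ⊎ det (σ q ^M k) ≡ - + 1
det-σ^ q zero = inj₁ refl
det-σ^ q (suc k) = Sum.swap (Sum.map negated negated (det-σ^ q k))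
  where
  det-σ^suc : det (σ q ^M suc k) ≡ - det (σ q ^M k)
  det-σ^suc = trans (det-⊗ (σ q) (σ q ^M k))
    (trans (cong (λ e → (e - + 1) * det (σ q ^M k)) (*-zeroʳ q)) (-1*i≡-i (det (σ q ^M k))))
  negated : ∀ {e} → det (σ q ^M k) ≡ e → det (σ q ^M suc k) ≡ - e
  negated e = trans det-σ^suc (cong -_ e)

-- The powers of σ q are (F (k+1), F k; F k, F (k−1)) for the sequence F = w 0 1 q.
fibMat : ℤ → ℤ → ℤ → Mat2
fibMat q x y = mat (q * x + y) x x y

σ^-fibMat : ∀ q k → ∃₂ λ x y → σ q ^M k ≡ fibMat q x y
σ^-fibMat q zero = + 0 , + 1 , cong (λ z → mat z (+ 0) (+ 0) (+ 1)) (sym (identity q))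
  where
  identity : ∀ q → q * + 0 + + 1 ≡ + 1
  identity = solve-∀
σ^-fibMat q (suc k) =
  let x , y , σ^k≡ = σ^-fibMat q k
  in q * x + y , x , trans (cong (σ q ⊗_) σ^k≡) (σ⊗fibMat x y)
  where
  σ⊗fibMat : ∀ x y → σ q ⊗ fibMat q x y ≡ fibMat q (q * x + y) x
  σ⊗fibMat x y = mat-cong (identity₁ q x y) (identity₂ q x y) (identity₃ q x y) (identity₄ x y)
    where
    mat-cong : ∀ {a b c d a′ b′ c′ d′} → a ≡ a′ → b ≡ b′ → c ≡ c′ → d ≡ d′ → mat a b c d ≡ mat a′ b′ c′ d′
    mat-cong refl refl refl refl = refl
    identity₁ : ∀ q x y → q * (q * x + y) + + 1 * x ≡ q * (q * x + y) + x
    identity₁ = solve-∀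
    identity₂ : ∀ q x y → q * x + + 1 * y ≡ q * x + y
    identity₂ = solve-∀
    identity₃ : ∀ q x y → + 1 * (q * x + y) + + 0 * x ≡ q * x + y
    identity₃ = solve-∀
    identity₄ : ∀ x y → + 1 * x + + 0 * y ≡ x
    identity₄ = solve-∀

fibMat-≡M-I₂ : ∀ {n q x y} → x ≡ + 0 ⟨mod n ⟩ → y ≡ + 1 ⟨mod n ⟩ → (fibMat q x y) ≡M I₂ [mod n ]
fibMat-≡M-I₂ {q = q} x≡0 y≡1 =
  unmod (mod-trans (mod-+-cong (mod-*-cong (mod-refl {x = q}) x≡0) y≡1) (mod-reflexive (cong (_+ + 1) (*-zeroʳ q))))
  , unmod x≡0 , unmod x≡0 , unmod y≡1

infixr 7 _·_

_·_ : Mat2 → ℤ × ℤ → ℤ × ℤ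
A · (x , y) = m11 A * x + m12 A * y , m21 A * x + m22 A * y

⊗-· : ∀ A B v → (A ⊗ B) · v ≡ A · B · v
⊗-· (mat a b c d) (mat e f g h) (x , y) = cong₂ _,_ (identity a b e f g h x y) (identity c d e f g h x y)
  where
  identity : ∀ a b e f g h x y → (a * e + b * g) * x + (a * f + b * h) * y ≡ a * (e * x + f * y) + b * (g * x + h * y)
  identity = solve-∀

I₂-· : ∀ v → I₂ · v ≡ v
I₂-· (x , y) = cong₂ _,_ (identity₁ x y) (identity₂ x y)
  where
  identity₁ : ∀ x y → + 1 * x + + 0 * y ≡ x
  identity₁ = solve-∀
  identity₂ : ∀ x y → + 0 * x + + 1 * y ≡ y
  identity₂ = solve-∀

module _ (a b q : ℤ) where

  private
    W : ℕ → ℤ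
    W = w a b q

  form-w≡±1 : ∀ {n} → form q a b ≡± + 1 ⟨mod n ⟩ → ∀ r → form q (W r) (W (suc r)) ≡± + 1 ⟨mod n ⟩
  form-w≡±1 N≡±1 zero = N≡±1
  form-w≡±1 N≡±1 (suc r) =
    subst (_≡± + 1 ⟨mod _ ⟩) (sym (identity q (W r) (W (suc r)))) (≡±-neg (form-w≡±1 N≡±1 r))
    where
    identity : ∀ q A B → B * B + q * B * (q * B + A) - (q * B + A) * (q * B + A) ≡ - (A * A + q * A * B - B * B)
    identity = solve-∀

  window : ℕ → ℤ × ℤ
  window n = W (suc n) , W n

  σ·window : ∀ n → σ q · window n ≡ window (suc n)
  σ·window n = cong₂ _,_ (identity₁ q (W (suc n)) (W n)) (identity₂ (W (suc n)) (W n))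
    where
    identity₁ : ∀ q x y → q * x + + 1 * y ≡ q * x + y
    identity₁ = solve-∀
    identity₂ : ∀ x y → + 1 * x + + 0 * y ≡ x
    identity₂ = solve-∀

  σ^·window : ∀ k n → σ q ^M k · window n ≡ window (k +ℕ n)
  σ^·window zero n = I₂-· (window n)
  σ^·window (suc k) n = begin
    (σ q ⊗ (σ q ^M k)) · window n  ≡⟨ ⊗-· (σ q) (σ q ^M k) (window n) ⟩
    σ q · σ q ^M k · window n      ≡⟨ cong (σ q ·_) (σ^·window k n) ⟩
    σ q · window (k +ℕ n)          ≡⟨ σ·window (k +ℕ n) ⟩
    window (suc k +ℕ n)            ∎
    where open ≡-Reasoning

  w-shift : ∀ k n → W (k +ℕ n) ≡ m21 (σ q ^M k) * W (suc n) + m22 (σ q ^M k) * W n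
  w-shift k n = sym (cong proj₂ (σ^·window k n))

module Period (a b q : ℤ) (M k : ℕ) (s u : ℤ) (σ^k≡ : σ q ^M k ≡ fibMat q (+ M * s) (+ 1 + + M * u)) where

  private
    W : ℕ → ℤ
    W = w a b q

  d : ℕ → ℤ
  d n = s * W (suc n) + u * W n

  w-step : ∀ n → W (k +ℕ n) ≡ W n + + M * d n
  w-step n = begin
    W (k +ℕ n)                                         ≡⟨ w-shift a b q k n ⟩
    m21 (σ q ^M k) * W (suc n) + m22 (σ q ^M k) * W n  ≡⟨ cong (λ A → m21 A * W (suc n) + m22 A * W n) σ^k≡ ⟩
    + M * s * W (suc n) + (+ 1 + + M * u) * W n        ≡⟨ identity (+ M) s u (W (suc n)) (W n) ⟩
    W n + + M * d n                                    ∎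
    where
    open ≡-Reasoning
    identity : ∀ m s u B A → m * s * B + (+ 1 + m * u) * A ≡ A + m * (s * B + u * A)
    identity = solve-∀

  private
    reassoc : ∀ j n → suc j *ℕ k +ℕ n ≡ k +ℕ (j *ℕ k +ℕ n)
    reassoc j n = ℕ.+-assoc k (j *ℕ k) n

  w-periodic : ∀ j n → W (j *ℕ k +ℕ n) ≡ W n ⟨mod + M ⟩
  w-periodic zero n = mod-refl
  w-periodic (suc j) n = begin
    W (suc j *ℕ k +ℕ n)                          ≡⟨ cong W (reassoc j n) ⟩
    W (k +ℕ (j *ℕ k +ℕ n))                       ≡⟨ w-step (j *ℕ k +ℕ n) ⟩
    W (j *ℕ k +ℕ n) + + M * d (j *ℕ k +ℕ n)      ≈⟨ ∣⇒+-mod (Signed.∣m⇒∣m*n (d (j *ℕ k +ℕ n)) Signed.∣-refl) ⟩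
    W (j *ℕ k +ℕ n)                              ≈⟨ w-periodic j n ⟩
    W n                                          ∎
    where open SetoidReasoning (mod-setoid (+ M))

  d-periodic : ∀ j n → d (j *ℕ k +ℕ n) ≡ d n ⟨mod + M ⟩
  d-periodic j n = mod-+-cong (mod-*-cong (mod-refl {x = s}) W-suc-periodic) (mod-*-cong (mod-refl {x = u}) (w-periodic j n))
    where
    W-suc-periodic : W (suc (j *ℕ k +ℕ n)) ≡ W (suc n) ⟨mod + M ⟩
    W-suc-periodic = mod-trans (mod-reflexive (cong W (sym (ℕ.+-suc (j *ℕ k) n)))) (w-periodic j (suc n))

  w-linear : ∀ {p} → + p ∣ₛ + M → ∀ j n → W (j *ℕ k +ℕ n) ≡ W n + + j * (+ M * d n) ⟨mod + (p *ℕ M) ⟩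
  w-linear p∣M zero n = mod-reflexive (sym (+-identityʳ (W n)))
  w-linear {p} p∣M (suc j) n = begin
    W (suc j *ℕ k +ℕ n)                       ≡⟨ cong W (reassoc j n) ⟩
    W (k +ℕ (j *ℕ k +ℕ n))                    ≡⟨ w-step (j *ℕ k +ℕ n) ⟩
    W (j *ℕ k +ℕ n) + + M * d (j *ℕ k +ℕ n)   ≈⟨ mod-+-cong (w-linear p∣M j n) (*-lift-mod p∣M (d-periodic j n)) ⟩
    W n + + j * (+ M * d n) + + M * d n       ≡⟨ identity (W n) (+ j) (+ M * d n) ⟩
    W n + (+ 1 + + j) * (+ M * d n)           ≡⟨ cong (λ i → W n + i * (+ M * d n)) (sym (pos-+ 1 j)) ⟩
    W n + + suc j * (+ M * d n)               ∎
    where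
    open SetoidReasoning (mod-setoid (+ (p *ℕ M)))
    identity : ∀ w j e → w + j * e + e ≡ w + (+ 1 + j) * e
    identity = solve-∀

lift-residue-complete : ∀ (W d : ℕ → ℤ) M k
  → (∀ j n → W (j *ℕ k +ℕ n) ≡ W n + + j * (+ M * d n) ⟨mod + (5 *ℕ M) ⟩)
  → (∀ n → ¬ (+ 5 ∣ₛ d n))
  → ResidueComplete W M → ResidueComplete W (5 *ℕ M)
lift-residue-complete W d M k w-linear 5∤d complete c =
  let r , Wr≡c = complete c
      t , Wr≡c+Mt = mod-witness (mod {W r} {c} {+ M} Wr≡c)
      j , 5∣t+jd = linear-solvable-mod5 t (d r) (5∤d r)
  in j *ℕ k +ℕ r , unmod (begin
    W (j *ℕ k +ℕ r)                    ≈⟨ w-linear j r ⟩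
    W r + + j * (+ M * d r)            ≡⟨ cong (λ x → x + + j * (+ M * d r)) Wr≡c+Mt ⟩
    c + + M * t + + j * (+ M * d r)    ≡⟨ identity c (+ M) t (+ j) (d r) ⟩
    c + + M * (t + + j * d r)          ≈⟨ ∣⇒+-mod (p∣x⇒pM∣Mx {M = M} 5∣t+jd) ⟩
    c                                  ∎)
  where
  open SetoidReasoning (mod-setoid (+ (5 *ℕ M)))
  identity : ∀ c m t j d → c + m * t + j * (m * d) ≡ c + m * (t + j * d)
  identity = solve-∀

σ^k-expansion : ∀ q k M → (σ q ^M k) ≡M I₂ [mod + M ]
              → ∃₂ λ s u → σ q ^M k ≡ fibMat q (+ M * s) (+ 1 + + M * u)
σ^k-expansion q k M σ^k≡I =
  let x , y , σ^k≡ = σ^-fibMat q k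
      _ , _ , x≡0 , y≡1 = subst (_≡M I₂ [mod + M ]) σ^k≡ σ^k≡I
      s , x≡Ms = mod-witness (mod {x} {+ 0} {+ M} x≡0)
      u , y≡1+Mu = mod-witness (mod {y} {+ 1} {+ M} y≡1)
  in s , u , trans σ^k≡ (cong₂ (fibMat q) (trans x≡Ms (+-identityˡ _)) y≡1+Mu)

1+mg≡±1⇒g≡0 : ∀ {m g} → m ≢ + 0 → ¬ (m ∣ₛ + 2) → + 1 + m * g ≡ + 1 ⊎ + 1 + m * g ≡ - + 1 → g ≡ + 0
1+mg≡±1⇒g≡0 {m} {g} m≢0 m∤2 (inj₁ 1+mg≡1) =
  Sum.[ ⊥-elim ∘ m≢0 , id ]′ (i*j≡0⇒i≡0∨j≡0 m (trans (identity (m * g)) (cong (_- + 1) 1+mg≡1)))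
  where
  identity : ∀ x → x ≡ + 1 + x - + 1
  identity = solve-∀
1+mg≡±1⇒g≡0 {m} {g} m≢0 m∤2 (inj₂ 1+mg≡-1) =
  ⊥-elim (m∤2 (divides (- g) (trans (cong (-_ ∘ (_- + 1)) (sym 1+mg≡-1)) (identity m g))))
  where
  identity : ∀ m g → - (+ 1 + m * g - + 1) ≡ - g * m
  identity = solve-∀

5∣qs+2u : ∀ q k M s u → + M ≢ + 0 → + 5 ∣ₛ + M → σ q ^M k ≡ fibMat q (+ M * s) (+ 1 + + M * u)
        → + 5 ∣ₛ q * s + + 2 * u
5∣qs+2u q k M s u M≢0 5∣M σ^k≡ = Signed.∣-trans 5∣M (divides (- F) (begin
  q * s + + 2 * u    ≡⟨ identity₂ q s u (+ M) ⟩
  G - + M * F        ≡⟨ cong (_- + M * F) G≡0 ⟩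
  + 0 - + M * F      ≡⟨ identity₃ (+ M) F ⟩
  - F * + M          ∎))
  where
  open ≡-Reasoning
  F G : ℤ
  F = q * s * u + u * u - s * s
  G = q * s + + 2 * u + + M * F
  identity₁ : ∀ q s u m → (q * (m * s) + (+ 1 + m * u)) * (+ 1 + m * u) - m * s * (m * s)
                        ≡ + 1 + m * (q * s + + 2 * u + m * (q * s * u + u * u - s * s))
  identity₁ = solve-∀
  identity₂ : ∀ q s u m → q * s + + 2 * u
                        ≡ (q * s + + 2 * u + m * (q * s * u + u * u - s * s)) - m * (q * s * u + u * u - s * s)
  identity₂ = solve-∀
  identity₃ : ∀ m f → + 0 - m * f ≡ - f * m
  identity₃ = solve-∀
  det≡1+MG : ∀ {e} → det (σ q ^M k) ≡ e → + 1 + + M * G ≡ e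
  det≡1+MG = trans (sym (trans (cong det σ^k≡) (identity₁ q s u (+ M))))
  G≡0 : G ≡ + 0
  G≡0 = 1+mg≡±1⇒g≡0 M≢0 (from-no (+ 5 ∣ₛ? + 2) ∘ Signed.∣-trans 5∣M)
    (Sum.map det≡1+MG det≡1+MG (det-σ^ q k))

¬[5∣s×5∣u] : ∀ q k M s u → 0 <ℕ k → IsOrder q (5 *ℕ M) (5 *ℕ k)
           → σ q ^M k ≡ fibMat q (+ M * s) (+ 1 + + M * u) → ¬ (+ 5 ∣ₛ s × + 5 ∣ₛ u)
¬[5∣s×5∣u] q k M s u 0<k (_ , _ , minimal) σ^k≡ (5∣s , 5∣u) =
  minimal k 0<k (ℕ.m<m+n k (ℕ.<-≤-trans 0<k (ℕ.m≤m+n k (3 *ℕ k))))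
    (subst (_≡M I₂ [mod + (5 *ℕ M) ]) (sym σ^k≡)
      (fibMat-≡M-I₂ {q = q} (∣⇒≡0-mod (p∣x⇒pM∣Mx {M = M} 5∣s))
                            (∣⇒+-mod (p∣x⇒pM∣Mx {M = M} 5∣u))))

lemma4p3 : (a b q : ℤ) → (m : ℕ) → q ≢ + 0
  → ¬ (+ 5 ∣ q * (q * q + + 4))
  → 0 <ℕ m → + 5 ∣ + m
  → ((a * a + q * a * b - b * b) ≡ + 1 [mod + 5 ]) ⊎ ((a * a + q * a * b - b * b) ≡ - + 1 [mod + 5 ])
  → (∃ λ k → IsOrder q m k × IsOrder q (5 *ℕ m) (5 *ℕ k))
  → ResidueComplete (w a b q) m
  → ResidueComplete (w a b q) (5 *ℕ m)
lemma4p3 a b q zero _ _ () _ _ _ _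
lemma4p3 a b q m@(suc _) _ 5∤q[q²+4] _ 5∣m N≡±1 (k , (0<k , σ^k≡I , _) , order-5k) complete
  with σ^k-expansion q k m σ^k≡I
... | s , u , σ^k≡ = lift-residue-complete (w a b q) d m k (w-linear 5∣m′) 5∤d complete
  where
  open Period a b q m k s u σ^k≡
  5∣m′ : + 5 ∣ₛ + m
  5∣m′ = Signed.∣ᵤ⇒∣ {+ 5} {+ m} 5∣m
  5∤d : ∀ r → ¬ (+ 5 ∣ₛ d r)
  5∤d r = 5∤sB+uA q s u (w a b q r) (w a b q (suc r)) (5∤q[q²+4] ∘ Signed.∣⇒∣ᵤ)
    (5∣qs+2u q k m s u (λ ()) 5∣m′ σ^k≡) (¬[5∣s×5∣u] q k m s u 0<k order-5k σ^k≡)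
    (form-w≡±1 a b q (Sum.map (mod {n = + 5}) (mod {n = + 5}) N≡±1) r)
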